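{- Let $I\subseteq[n]$ with $|I|=t$ and let $\pi$ be a uniformly random permutation of $[n]$. Let $C\subseteq[t]$ with $|C|=c$ and $J_C:=\bigcup_{k\in C}J_k$. Then for every real $0<x<1$, $$\mathbf{E}\left[x^{|J_C|}\right]\le\left(\frac{t}{n(1-x)}\right)^c.$$
   Context: Given $I\subseteq[n]$ of size $t$ and a permutation $\pi$ of $[n]$ (with $\pi^{ -1}(x)$ the position of $x$), let $\sigma:[t]\to I$ be the bijection with $\pi^{ -1}(\sigma(1))<\dots<\pi^{ -1}(\sigma(t))$, and set $\pi^{ -1}(\sigma(0)):=0$, $\pi^{ -1}(\sigma(t+1)):=n+1$. For $k=0,\dots,t$, $J_k$ is the set of indices $j\in[n]\setminus I$ with $\pi^{ -1}(\sigma(k))<\pi^{ -1}(j)<\pi^{ -1}(\sigma(k+1))$.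
   Formalization: The parameter x ranges over the rationals with $0<x<1$ rather than over the reals. -}

module Defs where

open import Data.Nat as ℕ using (ℕ; zero; suc)
open import Data.Bool using (Bool; true; false; not; _∧_; _∨_; if_then_else_)
open import Data.Fin as Fin using (Fin; toℕ)
open import Data.Fin.Subset using (Subset; _∈_; ∣_∣)
open import Data.Fin.Properties using (_≟_)
open import Data.Vec as Vec using (Vec; []; _∷_; lookup; toList)
open import Data.List as List using (List; []; _∷_; _++_; concatMap; filter; allFin; length; map; foldr)
open import Data.List.Relation.Unary.Unique.Propositional using (Unique)
import Data.List.Relation.Unary.Unique.DecPropositional as UDec
open import Data.Rational as ℚ using (ℚ; 0ℚ; 1ℚ; _+_; _*_)
open import Relation.Nullary.Decidable using (⌊_⌋)
open import Data.Fin.Subset.Properties using (_∈?_)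
open import Data.Nat using (_<ᵇ_; _≡ᵇ_)

_^ℚ_ : ℚ → ℕ → ℚ
x ^ℚ zero = 1ℚ
x ^ℚ suc k = x * (x ^ℚ k)

-- A permutation π of [n] is represented by its one-line notation
-- (π(1), …, π(n)) : Vec (Fin n) n with pairwise distinct entries
-- (elements of [n] are Fin n; position p ∈ [n] is index p-1).

words : (n m : ℕ) → List (Vec (Fin n) m)
words n zero    = [] ∷ []
words n (suc m) = concatMap (λ a → map (a ∷_) (words n m)) (allFin n)

perms : (n : ℕ) → List (Vec (Fin n) n)
perms n = filter (λ w → UDec.unique? {A = Fin n} _≟_ (toList w)) (words n n)

memb : ∀ {n} → Fin n → Subset n → Bool
memb i I = ⌊ i ∈? I ⌋

-- π⁻¹(x): the position (1-based) of x in the one-line notation of π.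
posOf : ∀ {n m} → Vec (Fin n) m → Fin n → ℕ
posOf []       x = 0
posOf (y ∷ ys) x = if ⌊ y ≟ x ⌋ then 1 else suc (posOf ys x)

-- Positions p ∈ [n] (1-based, increasing) with π(p) ∈ I; i.e. the list
-- π⁻¹(σ(1)) < … < π⁻¹(σ(t)).
posI : ∀ {n} → Subset n → Vec (Fin n) n → List ℕ
posI {n} I π = map (λ p → suc (toℕ p)) (filter (λ p → lookup π p ∈? I) (allFin n))

-- Bounds list: 0 = π⁻¹(σ(0)), π⁻¹(σ(1)), …, π⁻¹(σ(t)), n+1 = π⁻¹(σ(t+1)).
bounds : ∀ {n} → Subset n → Vec (Fin n) n → List ℕ
bounds {n} I π = 0 ∷ (posI I π ++ (suc n ∷ []))

-- k-th entry of a list of naturals (default 0 out of range; not used out of range).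
nth : List ℕ → ℕ → ℕ
nth []       _       = 0
nth (a ∷ as) zero    = a
nth (a ∷ as) (suc k) = nth as k

inJ : ∀ {n} → Subset n → Vec (Fin n) n → ℕ → Fin n → Bool
inJ I π k j =
  not (memb j I) ∧ ((nth (bounds I π) k <ᵇ posOf π j) ∧ (posOf π j <ᵇ nth (bounds I π) (suc k)))

-- j ∈ J_C = ⋃_{k ∈ C} J_k, where C ⊆ [t] is a Subset t and the element
-- i : Fin t of C stands for k = toℕ i + 1 ∈ [t].
inJC : ∀ {n t} → Subset n → Subset t → Vec (Fin n) n → Fin n → Bool
inJC {t = t} I C π j =
  foldr _∨_ false (map (λ i → memb i C ∧ inJ I π (suc (toℕ i)) j) (allFin t))

sizeJC : ∀ {n t} → Subset n → Subset t → Vec (Fin n) n → ℕ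
sizeJC {n} I C π = length (filter (λ j → Data.Bool._≟_ (inJC I C π j) true) (allFin n))

sumℚ : List ℚ → ℚ
sumℚ = foldr _+_ 0ℚ

-- 1/N for N ≥ 1 (0 for N = 0, which never occurs for perms).
invℕ : ℕ → ℚ
invℕ zero    = 0ℚ
invℕ (suc k) = Data.Integer.+_ 1 ℚ./ suc k
  where import Data.Integer

E-perm : (n : ℕ) → (Vec (Fin n) n → ℚ) → ℚ
E-perm n f = sumℚ (map f (perms n)) * invℕ (length (perms n))

-- Read left to right, a permutation places the t letters of I and the v = n - t other
-- letters; the letters of I close the gaps J_0, …, J_t one after another.  Each way of
-- splitting v into gap sizes (g_0, …, g_t) is realised by t! v! permutations, so
--   E[x^|J_C|] = h_v(w) / h_v(1, …, 1),   w_k = x for k ∈ C and w_k = 1 otherwise,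
-- with h_v the complete homogeneous symmetric polynomial of degree v in t + 1 variables.
-- By symmetry the c weights x may come first; splitting off the d + 1 = t + 1 - c ones gives
--   h_v(w) ≤ C(d+v, d) · ∑_{s ≤ v} C(s+c-1, s) x^s ≤ C(d+v, d) · (1 - x)^(-c),
-- and C(d+v, d) / C(t+v, t) = ∏_{i=1}^{c} (d+i)/(d+v+i) ≤ (t/n)^c.
module Submission where

open import Defs
open import Data.Bool using (Bool; true; false; if_then_else_; not; _∧_; _∨_)
import Data.Bool.Properties as Boolₚ
open import Data.Nat as ℕ using (ℕ; zero; suc; pred; _!; _<ᵇ_; _≡ᵇ_)
import Data.Nat.Properties as ℕₚ
open import Data.Integer as ℤ using (+_)
import Data.Integer.Properties as ℤₚ
open import Data.Rational as ℚ using (ℚ; 0ℚ; 1ℚ; _+_; _*_; _-_; _/_; _≤_; _<_; toℚᵘ)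
import Data.Rational.Properties as ℚₚ
import Data.Rational.Unnormalised as ℚᵘ
import Data.Rational.Unnormalised.Properties as ℚᵘₚ
open import Data.Rational.Solver using (module +-*-Solver)
open import Data.Product using (_,_; _×_; proj₁; proj₂; ∃)
open import Data.Fin as Fin using (Fin; toℕ)
open import Data.Fin.Properties as Finₚ using (_≟_)
open import Data.Fin.Subset using (Subset; ∣_∣; ∁)
import Data.Fin.Subset.Properties as Subsetₚ
open import Data.Vec as Vec using (Vec; toList)
import Data.Vec.Properties as Vecₚ
open import Data.List as List using (List; []; _∷_; _++_; [_]; replicate; map; length; filter; allFin; tabulate)
import Data.List.Properties as Listₚ
open import Data.List.Relation.Unary.All as All using (All)
import Data.List.Relation.Unary.All.Properties as Allₚ
import Data.List.Relation.Unary.Unique.DecPropositional as UniqueDec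
open import Data.List.Relation.Binary.Permutation.Propositional as ↭ using (_↭_)
import Data.List.Relation.Binary.Permutation.Propositional.Properties as ↭ₚ
import Algebra.Properties.CommutativeMonoid.Sum as MonoidSum
open import Function using (_∘_)
open import Relation.Nullary using (Dec; ¬?; contradiction)
open import Relation.Nullary.Decidable using (does; yes; no; dec-true; isYes≗does)
open import Relation.Binary.PropositionalEquality hiding ([_])

open +-*-Solver

-- Opaque, so that normalisation never unfolds the gcd computations behind + n / 1.
opaque
  fromℕ : ℕ → ℚ
  fromℕ n = + n / 1

  fromℕ≡/1 : ∀ n → fromℕ n ≡ + n / 1
  fromℕ≡/1 n = refl

  private
    toℚᵘ-fromℕ : ∀ n → toℚᵘ (fromℕ n) ℚᵘ.≃ ℚᵘ.mkℚᵘ (+ n) 0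
    toℚᵘ-fromℕ n = ℚₚ.toℚᵘ-fromℚᵘ (ℚᵘ.mkℚᵘ (+ n) 0)

  fromℕ-+ : ∀ m n → fromℕ (m ℕ.+ n) ≡ fromℕ m + fromℕ n
  fromℕ-+ m n = ℚₚ.toℚᵘ-injective (begin
    toℚᵘ (fromℕ (m ℕ.+ n))                ≈⟨ toℚᵘ-fromℕ (m ℕ.+ n) ⟩
    ℚᵘ.mkℚᵘ (+ (m ℕ.+ n)) 0               ≈⟨ ℚᵘ.*≡* eq ⟨
    ℚᵘ.mkℚᵘ (+ m) 0 ℚᵘ.+ ℚᵘ.mkℚᵘ (+ n) 0  ≈⟨ ℚᵘₚ.+-cong (toℚᵘ-fromℕ m) (toℚᵘ-fromℕ n) ⟨
    toℚᵘ (fromℕ m) ℚᵘ.+ toℚᵘ (fromℕ n)    ≈⟨ ℚₚ.toℚᵘ-homo-+ (fromℕ m) (fromℕ n) ⟨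
    toℚᵘ (fromℕ m + fromℕ n)              ∎)
    where
    open ℚᵘₚ.≃-Reasoning
    eq : (+ m ℤ.* + 1 ℤ.+ + n ℤ.* + 1) ℤ.* + 1 ≡ + (m ℕ.+ n) ℤ.* (+ 1 ℤ.* + 1)
    eq rewrite ℤₚ.*-identityʳ (+ m) | ℤₚ.*-identityʳ (+ n) =
      trans (ℤₚ.*-identityʳ _) (trans (sym (ℤₚ.pos-+ m n)) (sym (ℤₚ.*-identityʳ _)))

  fromℕ-* : ∀ m n → fromℕ (m ℕ.* n) ≡ fromℕ m * fromℕ n
  fromℕ-* m n = ℚₚ.toℚᵘ-injective (begin
    toℚᵘ (fromℕ (m ℕ.* n))                ≈⟨ toℚᵘ-fromℕ (m ℕ.* n) ⟩
    ℚᵘ.mkℚᵘ (+ (m ℕ.* n)) 0               ≈⟨ ℚᵘ.*≡* eq ⟨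
    ℚᵘ.mkℚᵘ (+ m) 0 ℚᵘ.* ℚᵘ.mkℚᵘ (+ n) 0  ≈⟨ ℚᵘₚ.*-cong (toℚᵘ-fromℕ m) (toℚᵘ-fromℕ n) ⟨
    toℚᵘ (fromℕ m) ℚᵘ.* toℚᵘ (fromℕ n)    ≈⟨ ℚₚ.toℚᵘ-homo-* (fromℕ m) (fromℕ n) ⟨
    toℚᵘ (fromℕ m * fromℕ n)              ∎)
    where
    open ℚᵘₚ.≃-Reasoning
    eq : (+ m ℤ.* + n) ℤ.* + 1 ≡ + (m ℕ.* n) ℤ.* (+ 1)
    eq rewrite sym (ℤₚ.pos-* m n) = refl

  fromℕ-0 : fromℕ 0 ≡ 0ℚ
  fromℕ-0 = refl

  fromℕ-1 : fromℕ 1 ≡ 1ℚ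
  fromℕ-1 = refl

  fromℕ-nonNeg : ∀ n → 0ℚ ≤ fromℕ n
  fromℕ-nonNeg n = ℚₚ.nonNegative⁻¹ (fromℕ n) {{ℚₚ.normalize-nonNeg n 1}}

  fromℕ-suc-pos : ∀ n → ℚ.Positive (fromℕ (suc n))
  fromℕ-suc-pos n = ℚₚ.normalize-pos (suc n) 1

  invℕ-inverse : ∀ k → invℕ (suc k) * fromℕ (suc k) ≡ 1ℚ
  invℕ-inverse k = ℚₚ.toℚᵘ-injective (begin
    toℚᵘ (invℕ (suc k) * fromℕ (suc k))             ≈⟨ ℚₚ.toℚᵘ-homo-* (invℕ (suc k)) (fromℕ (suc k)) ⟩
    toℚᵘ (invℕ (suc k)) ℚᵘ.* toℚᵘ (fromℕ (suc k))   ≈⟨ ℚᵘₚ.*-cong (ℚₚ.toℚᵘ-fromℚᵘ (ℚᵘ.mkℚᵘ (+ 1) k)) (toℚᵘ-fromℕ (suc k)) ⟩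
    ℚᵘ.mkℚᵘ (+ 1) k ℚᵘ.* ℚᵘ.mkℚᵘ (+ suc k) 0        ≈⟨ ℚᵘ.*≡* eq ⟩
    toℚᵘ 1ℚ                                         ∎)
    where
    open ℚᵘₚ.≃-Reasoning
    eq : (+ 1 ℤ.* + suc k) ℤ.* + 1 ≡ + 1 ℤ.* + (suc k ℕ.* 1)
    eq = trans (ℤₚ.*-identityʳ (+ 1 ℤ.* + suc k)) (cong (λ m → + 1 ℤ.* + m) (sym (ℕₚ.*-identityʳ (suc k))))


*-monoˡ-≤ : ∀ {r p q} → 0ℚ ≤ r → p ≤ q → r * p ≤ r * q
*-monoˡ-≤ {r} 0≤r = ℚₚ.*-monoˡ-≤-nonNeg r {{ℚ.nonNegative 0≤r}}

*-monoʳ-≤ : ∀ {r p q} → 0ℚ ≤ r → p ≤ q → p * r ≤ q * r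
*-monoʳ-≤ {r} 0≤r = ℚₚ.*-monoʳ-≤-nonNeg r {{ℚ.nonNegative 0≤r}}

*-nonNeg : ∀ {p q} → 0ℚ ≤ p → 0ℚ ≤ q → 0ℚ ≤ p * q
*-nonNeg {p} 0≤p 0≤q = ℚₚ.≤-trans (ℚₚ.≤-reflexive (sym (ℚₚ.*-zeroʳ p))) (*-monoˡ-≤ 0≤p 0≤q)

≤-+ʳ : ∀ {p q} → 0ℚ ≤ q → p ≤ p + q
≤-+ʳ {p} 0≤q = ℚₚ.≤-trans (ℚₚ.≤-reflexive (sym (ℚₚ.+-identityʳ p))) (ℚₚ.+-monoʳ-≤ p 0≤q)

≤⇒0≤- : ∀ {p q} → p ≤ q → 0ℚ ≤ q - p
≤⇒0≤- {p} p≤q =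
  ℚₚ.≤-trans (ℚₚ.≤-reflexive (sym (ℚₚ.+-inverseʳ p))) (ℚₚ.+-monoˡ-≤ (ℚ.- p) p≤q)

1-nonNeg : 0ℚ ≤ 1ℚ
1-nonNeg = ℚₚ.nonNegative⁻¹ 1ℚ

^ℚ-nonNeg : ∀ {p} c → 0ℚ ≤ p → 0ℚ ≤ p ^ℚ c
^ℚ-nonNeg zero    0≤p = 1-nonNeg
^ℚ-nonNeg (suc c) 0≤p = *-nonNeg 0≤p (^ℚ-nonNeg c 0≤p)

*-^ℚ : ∀ p q c → (p * q) ^ℚ c ≡ p ^ℚ c * q ^ℚ c
*-^ℚ p q zero    = refl
*-^ℚ p q (suc c) rewrite *-^ℚ p q c =
  solve 4 (λ p q P Q → (p :* q) :* (P :* Q) := (p :* P) :* (q :* Q)) refl p q (p ^ℚ c) (q ^ℚ c)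

1^ℚ : ∀ c → 1ℚ ^ℚ c ≡ 1ℚ
1^ℚ zero    = refl
1^ℚ (suc c) rewrite 1^ℚ c = refl

fromℕ-suc : ∀ n → fromℕ (suc n) ≡ 1ℚ + fromℕ n
fromℕ-suc n = trans (fromℕ-+ 1 n) (cong (_+ fromℕ n) fromℕ-1)

fromℕ-mono-≤ : ∀ {m n} → m ℕ.≤ n → fromℕ m ≤ fromℕ n
fromℕ-mono-≤ {m} m≤n with ℕₚ.m≤n⇒∃[o]m+o≡n m≤n
... | o , refl = ℚₚ.≤-trans (≤-+ʳ (fromℕ-nonNeg o)) (ℚₚ.≤-reflexive (sym (fromℕ-+ m o)))

fromℕ-! : ∀ k → fromℕ (suc k !) ≡ (1ℚ + fromℕ k) * fromℕ (k !)
fromℕ-! k = trans (fromℕ-* (suc k) (k !)) (cong (_* fromℕ (k !)) (fromℕ-suc k))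

invℕ-nonNeg : ∀ k → 0ℚ ≤ invℕ k
invℕ-nonNeg zero    = ℚₚ.≤-refl
invℕ-nonNeg (suc k) = ℚₚ.nonNegative⁻¹ (invℕ (suc k)) {{ℚₚ.normalize-nonNeg 1 (suc k)}}

-- Complete homogeneous symmetric polynomials

-- h ws v = h_v(ws), the coefficient of y^v in ∏_{w ∈ ws} 1/(1 - w y).
h : List ℚ → ℕ → ℚ
h ws       zero    = 1ℚ
h []       (suc v) = 0ℚ
h (w ∷ ws) (suc v) = h ws (suc v) + w * h (w ∷ ws) v

h-nonNeg : ∀ {ws} → All (0ℚ ≤_) ws → ∀ v → 0ℚ ≤ h ws v
h-nonNeg _                  zero    = 1-nonNeg
h-nonNeg All.[]             (suc v) = ℚₚ.≤-refl
h-nonNeg (0≤w All.∷ 0≤ws) (suc v) =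
  ℚₚ.+-mono-≤ (h-nonNeg 0≤ws (suc v)) (*-nonNeg 0≤w (h-nonNeg (0≤w All.∷ 0≤ws) v))

h-singleton : ∀ w v → h [ w ] v ≡ w ^ℚ v
h-singleton w zero    = refl
h-singleton w (suc v) = trans (ℚₚ.+-identityˡ _) (cong (w *_) (h-singleton w v))

h-mono-1∷ : ∀ {ws} → All (0ℚ ≤_) ws → ∀ v → h (1ℚ ∷ ws) v ≤ h (1ℚ ∷ ws) (suc v)
h-mono-1∷ {ws} 0≤ws v = begin
  h (1ℚ ∷ ws) v                          ≤⟨ ≤-+ʳ (h-nonNeg 0≤ws (suc v)) ⟩
  h (1ℚ ∷ ws) v + h ws (suc v)           ≡⟨ ℚₚ.+-comm (h (1ℚ ∷ ws) v) (h ws (suc v)) ⟩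
  h ws (suc v) + h (1ℚ ∷ ws) v           ≡⟨ cong (λ p → h ws (suc v) + p) (sym (ℚₚ.*-identityˡ _)) ⟩
  h ws (suc v) + 1ℚ * h (1ℚ ∷ ws) v      ∎
  where open ℚₚ.≤-Reasoning

h-cong-∷ : ∀ w {ws ws'} → (∀ v → h ws v ≡ h ws' v) → ∀ v → h (w ∷ ws) v ≡ h (w ∷ ws') v
h-cong-∷ w eq zero    = refl
h-cong-∷ w eq (suc v) = cong₂ _+_ (eq (suc v)) (cong (w *_) (h-cong-∷ w eq v))

-- The coefficient of y^(2+v) in (1 - a y)(1 - b y) ∑ᵥ h (a ∷ b ∷ ws) v yᵛ = ∑ᵥ h ws v yᵛ;
-- its right-hand side is symmetric in a and b.
h-recurrence₂ : ∀ a b ws v →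
  h (a ∷ b ∷ ws) (suc (suc v)) ≡
  h ws (suc (suc v)) + (a + b) * h (a ∷ b ∷ ws) (suc v) - a * b * h (a ∷ b ∷ ws) v
h-recurrence₂ a b ws v =
  solve 5 (λ a b G B₁ Z → (G :+ b :* B₁) :+ a :* (B₁ :+ a :* Z)
                          := G :+ (a :+ b) :* (B₁ :+ a :* Z) :- a :* b :* Z)
    refl a b (h ws (suc (suc v))) (h (b ∷ ws) (suc v)) (h (a ∷ b ∷ ws) v)

h-swap : ∀ a b ws v → h (a ∷ b ∷ ws) v ≡ h (b ∷ a ∷ ws) v
h-swap a b ws zero          = refl
h-swap a b ws (suc zero)    =
  solve 3 (λ a b G → (G :+ b :* con 1ℚ) :+ a :* con 1ℚ := (G :+ a :* con 1ℚ) :+ b :* con 1ℚ)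
    refl a b (h ws 1)
h-swap a b ws (suc (suc v)) = begin
  h (a ∷ b ∷ ws) (2 ℕ.+ v)
    ≡⟨ h-recurrence₂ a b ws v ⟩
  h ws (2 ℕ.+ v) + (a + b) * h (a ∷ b ∷ ws) (suc v) - a * b * h (a ∷ b ∷ ws) v
    ≡⟨ cong₂ (λ p q → h ws (2 ℕ.+ v) + p - q)
         (cong₂ _*_ (ℚₚ.+-comm a b) (h-swap a b ws (suc v)))
         (cong₂ _*_ (ℚₚ.*-comm a b) (h-swap a b ws v)) ⟩
  h ws (2 ℕ.+ v) + (b + a) * h (b ∷ a ∷ ws) (suc v) - b * a * h (b ∷ a ∷ ws) v
    ≡⟨ sym (h-recurrence₂ b a ws v) ⟩
  h (b ∷ a ∷ ws) (2 ℕ.+ v) ∎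
  where open ≡-Reasoning

h-↭ : ∀ {ws ws'} → ws ↭ ws' → ∀ v → h ws v ≡ h ws' v
h-↭ ↭.refl           v = refl
h-↭ (↭.prep w p)     v = h-cong-∷ w (h-↭ p) v
h-↭ (↭.swap a b p)   v = trans (h-cong-∷ a (h-cong-∷ b (h-↭ p)) v) (h-swap a b _ v)
h-↭ (↭.trans p q)    v = trans (h-↭ p v) (h-↭ q v)

-- Multisets and the negative binomial series

multichoose : ℕ → ℕ → ℚ
multichoose k v = h (replicate k 1ℚ) v

ones-nonNeg : ∀ k → All (0ℚ ≤_) (replicate k 1ℚ)
ones-nonNeg k = Allₚ.replicate⁺ k 1-nonNeg

multichoose-nonNeg : ∀ k v → 0ℚ ≤ multichoose k v
multichoose-nonNeg k = h-nonNeg (ones-nonNeg k)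

multichoose-mono : ∀ k v → multichoose (suc k) v ≤ multichoose (suc k) (suc v)
multichoose-mono k = h-mono-1∷ (ones-nonNeg k)

multichoose-absorb : ∀ k v → multichoose k v * fromℕ (k ℕ.+ v) ≡ multichoose (suc k) v * fromℕ k
multichoose-absorb k       zero    = cong (λ m → 1ℚ * fromℕ m) (ℕₚ.+-identityʳ k)
multichoose-absorb zero    (suc v) = begin
  0ℚ * fromℕ (suc v)                 ≡⟨ ℚₚ.*-zeroˡ (fromℕ (suc v)) ⟩
  0ℚ                                 ≡⟨ sym (ℚₚ.*-zeroʳ (multichoose 1 (suc v))) ⟩
  multichoose 1 (suc v) * 0ℚ         ≡⟨ cong (λ q → multichoose 1 (suc v) * q) (sym fromℕ-0) ⟩
  multichoose 1 (suc v) * fromℕ 0    ∎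
  where open ≡-Reasoning
multichoose-absorb (suc k) (suc v) = begin
  (a + 1ℚ * b) * fromℕ (suc (k ℕ.+ suc v))
    ≡⟨ cong (λ q → (a + 1ℚ * b) * q) (fromℕ-suc (k ℕ.+ suc v)) ⟩
  (a + 1ℚ * b) * (1ℚ + s)
    ≡⟨ solve 3 (λ a b s → (a :+ con 1ℚ :* b) :* (con 1ℚ :+ s) := (a :+ con 1ℚ :* b) :+ a :* s :+ b :* s) refl a b s ⟩
  (a + 1ℚ * b) + a * s + b * s
    ≡⟨ cong₂ (λ p q → (a + 1ℚ * b) + p + q) (multichoose-absorb k (suc v)) b-absorb ⟩
  (a + 1ℚ * b) + (a + 1ℚ * b) * fromℕ k + c * fromℕ (suc k)
    ≡⟨ cong (λ q → (a + 1ℚ * b) + (a + 1ℚ * b) * fromℕ k + c * q) (fromℕ-suc k) ⟩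
  (a + 1ℚ * b) + (a + 1ℚ * b) * fromℕ k + c * (1ℚ + fromℕ k)
    ≡⟨ solve 4 (λ a b c K → (a :+ con 1ℚ :* b) :+ (a :+ con 1ℚ :* b) :* K :+ c :* (con 1ℚ :+ K)
                           := ((a :+ con 1ℚ :* b) :+ con 1ℚ :* c) :* (con 1ℚ :+ K)) refl a b c (fromℕ k) ⟩
  ((a + 1ℚ * b) + 1ℚ * c) * (1ℚ + fromℕ k)
    ≡⟨ cong (λ q → ((a + 1ℚ * b) + 1ℚ * c) * q) (sym (fromℕ-suc k)) ⟩
  ((a + 1ℚ * b) + 1ℚ * c) * fromℕ (suc k) ∎
  where
  open ≡-Reasoning
  a = multichoose k (suc v)
  b = multichoose (suc k) v
  c = multichoose (suc (suc k)) v
  s = fromℕ (k ℕ.+ suc v)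
  b-absorb : b * s ≡ c * fromℕ (suc k)
  b-absorb = trans (cong (λ m → b * fromℕ m) (ℕₚ.+-suc k v)) (multichoose-absorb (suc k) v)

m≤n⇒m*[n+o]≤n*[m+o] : ∀ {m n} o → m ℕ.≤ n → m ℕ.* (n ℕ.+ o) ℕ.≤ n ℕ.* (m ℕ.+ o)
m≤n⇒m*[n+o]≤n*[m+o] {m} {n} o m≤n = begin
  m ℕ.* (n ℕ.+ o)          ≡⟨ ℕₚ.*-distribˡ-+ m n o ⟩
  m ℕ.* n ℕ.+ m ℕ.* o      ≤⟨ ℕₚ.+-mono-≤ (ℕₚ.≤-reflexive (ℕₚ.*-comm m n)) (ℕₚ.*-monoˡ-≤ o m≤n) ⟩
  n ℕ.* m ℕ.+ n ℕ.* o      ≡⟨ ℕₚ.*-distribˡ-+ n m o ⟨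
  n ℕ.* (m ℕ.+ o)          ∎
  where open ℕₚ.≤-Reasoning

-- By absorption the two multichoose values are in the ratio (k+1+v) : (k+1), and
-- (k+1)(t+v) ≤ t(k+1+v).
multichoose-step : ∀ k t v → suc k ℕ.≤ t →
  multichoose (suc k) v * fromℕ (t ℕ.+ v) ≤ multichoose (suc (suc k)) v * fromℕ t
multichoose-step k t v k<t = ℚₚ.*-cancelʳ-≤-pos r {{fromℕ-suc-pos (k ℕ.+ v)}} (begin
  M₁ * fromℕ (t ℕ.+ v) * r          ≡⟨ solve 3 (λ M n r → M :* n :* r := (M :* r) :* n) refl M₁ (fromℕ (t ℕ.+ v)) r ⟩
  (M₁ * r) * fromℕ (t ℕ.+ v)        ≡⟨ cong (λ q → q * fromℕ (t ℕ.+ v)) (multichoose-absorb (suc k) v) ⟩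
  (M₂ * fromℕ (suc k)) * fromℕ (t ℕ.+ v)
                                    ≡⟨ ℚₚ.*-assoc M₂ _ _ ⟩
  M₂ * (fromℕ (suc k) * fromℕ (t ℕ.+ v))
                                    ≤⟨ *-monoˡ-≤ (multichoose-nonNeg (suc (suc k)) v) factors ⟩
  M₂ * (fromℕ t * r)                ≡⟨ sym (ℚₚ.*-assoc M₂ _ _) ⟩
  M₂ * fromℕ t * r                  ∎)
  where
  open ℚₚ.≤-Reasoning
  M₁ = multichoose (suc k) v
  M₂ = multichoose (suc (suc k)) v
  r  = fromℕ (suc k ℕ.+ v)
  factors : fromℕ (suc k) * fromℕ (t ℕ.+ v) ≤ fromℕ t * r
  factors = subst₂ _≤_ (fromℕ-* (suc k) (t ℕ.+ v)) (fromℕ-* t (suc k ℕ.+ v))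
                       (fromℕ-mono-≤ (m≤n⇒m*[n+o]≤n*[m+o] v k<t))

multichoose-ratio : ∀ c d v → let t = c ℕ.+ d in
  multichoose (suc d) v * fromℕ (t ℕ.+ v) ^ℚ c ≤ fromℕ t ^ℚ c * multichoose (suc t) v
multichoose-ratio zero    d v = ℚₚ.≤-reflexive (ℚₚ.*-comm (multichoose (suc d) v) 1ℚ)
multichoose-ratio (suc c) d v = begin
  M * (n * n ^ℚ c)                  ≡⟨ sym (ℚₚ.*-assoc M n _) ⟩
  (M * n) * n ^ℚ c                  ≤⟨ *-monoʳ-≤ (^ℚ-nonNeg c (fromℕ-nonNeg _)) step ⟩
  (M' * t) * n ^ℚ c                 ≡⟨ solve 3 (λ M' t N → (M' :* t) :* N := t :* (M' :* N)) refl M' t (n ^ℚ c) ⟩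
  t * (M' * n ^ℚ c)                 ≤⟨ *-monoˡ-≤ (fromℕ-nonNeg _) ih ⟩
  t * (t ^ℚ c * multichoose (suc (suc c ℕ.+ d)) v)
                                    ≡⟨ sym (ℚₚ.*-assoc t _ _) ⟩
  t * t ^ℚ c * multichoose (suc (suc c ℕ.+ d)) v ∎
  where
  open ℚₚ.≤-Reasoning
  M  = multichoose (suc d) v
  M' = multichoose (suc (suc d)) v
  t  = fromℕ (suc c ℕ.+ d)
  n  = fromℕ (suc c ℕ.+ d ℕ.+ v)
  step : M * n ≤ M' * t
  step = multichoose-step d (suc c ℕ.+ d) v (ℕ.s≤s (ℕₚ.m≤n+m d c))
  ih : M' * n ^ℚ c ≤ t ^ℚ c * multichoose (suc (suc c ℕ.+ d)) v
  ih = subst (λ m → M' * fromℕ (m ℕ.+ v) ^ℚ c ≤ fromℕ m ^ℚ c * multichoose (suc m) v)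
             (ℕₚ.+-suc c d) (multichoose-ratio c (suc d) v)

module NegativeBinomial (x : ℚ) (0≤x : 0ℚ ≤ x) where

  -- ∑_{s ≤ v} C(s+c-1, s) x^s, the v-th partial sum of the series of (1 - x)^(-c).
  partialSum : ℕ → ℕ → ℚ
  partialSum c v = h (replicate c x ++ [ 1ℚ ]) v

  weights-nonNeg : ∀ c → All (0ℚ ≤_) (replicate c x)
  weights-nonNeg c = Allₚ.replicate⁺ c 0≤x

  partialSum-zero : ∀ v → partialSum 0 v ≡ 1ℚ
  partialSum-zero v = trans (h-singleton 1ℚ v) (1^ℚ v)

  partialSum-nonNeg : ∀ c v → 0ℚ ≤ partialSum c v
  partialSum-nonNeg c = h-nonNeg (Allₚ.++⁺ (weights-nonNeg c) (1-nonNeg All.∷ All.[]))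

  partialSum-mono : ∀ c v → partialSum c v ≤ partialSum c (suc v)
  partialSum-mono c v = subst₂ _≤_ (h-↭ sorted v) (h-↭ sorted (suc v)) (h-mono-1∷ (weights-nonNeg c) v)
    where sorted = ↭ₚ.∷↭∷ʳ 1ℚ (replicate c x)

  partialSum-contract : ∀ c v → (1ℚ - x) * partialSum (suc c) v ≤ partialSum c v
  partialSum-contract c zero    = ℚₚ.≤-trans (ℚₚ.≤-reflexive (ℚₚ.*-identityʳ (1ℚ - x)))
                                             (ℚₚ.+-monoʳ-≤ 1ℚ (ℚₚ.neg-antimono-≤ 0≤x))
  partialSum-contract c (suc v) = begin
    (1ℚ - x) * (S (suc v) + x * S' v)
      ≡⟨ solve 3 (λ x S₁ S' → (con 1ℚ :- x) :* (S₁ :+ x :* S') := (con 1ℚ :- x) :* S₁ :+ x :* ((con 1ℚ :- x) :* S'))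
           refl x (S (suc v)) (S' v) ⟩
    (1ℚ - x) * S (suc v) + x * ((1ℚ - x) * S' v)
      ≤⟨ ℚₚ.+-monoʳ-≤ ((1ℚ - x) * S (suc v)) (*-monoˡ-≤ 0≤x (partialSum-contract c v)) ⟩
    (1ℚ - x) * S (suc v) + x * S v
      ≤⟨ ℚₚ.+-monoʳ-≤ ((1ℚ - x) * S (suc v)) (*-monoˡ-≤ 0≤x (partialSum-mono c v)) ⟩
    (1ℚ - x) * S (suc v) + x * S (suc v)
      ≡⟨ solve 2 (λ x S₁ → (con 1ℚ :- x) :* S₁ :+ x :* S₁ := S₁) refl x (S (suc v)) ⟩
    S (suc v) ∎
    where
    open ℚₚ.≤-Reasoning
    S  = partialSum c
    S' = partialSum (suc c)

  partialSum-bound : x ≤ 1ℚ → ∀ c v → (1ℚ - x) ^ℚ c * partialSum c v ≤ 1ℚ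
  partialSum-bound x≤1 zero    v = ℚₚ.≤-reflexive (trans (ℚₚ.*-identityˡ _) (partialSum-zero v))
  partialSum-bound x≤1 (suc c) v = begin
    (1ℚ - x) * (1ℚ - x) ^ℚ c * partialSum (suc c) v
      ≡⟨ solve 3 (λ y Y S → y :* Y :* S := Y :* (y :* S)) refl (1ℚ - x) ((1ℚ - x) ^ℚ c) (partialSum (suc c) v) ⟩
    (1ℚ - x) ^ℚ c * ((1ℚ - x) * partialSum (suc c) v)
      ≤⟨ *-monoˡ-≤ (^ℚ-nonNeg c (≤⇒0≤- x≤1)) (partialSum-contract c v) ⟩
    (1ℚ - x) ^ℚ c * partialSum c v
      ≤⟨ partialSum-bound x≤1 c v ⟩
    1ℚ ∎
    where open ℚₚ.≤-Reasoning

  h-split-bound : ∀ c d v →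
    h (replicate c x ++ replicate (suc d) 1ℚ) v ≤ multichoose (suc d) v * partialSum c v
  h-split-bound zero    d v       = ℚₚ.≤-reflexive (sym
    (trans (cong (λ q → multichoose (suc d) v * q) (partialSum-zero v)) (ℚₚ.*-identityʳ _)))
  h-split-bound (suc c) d zero    = ℚₚ.≤-refl
  h-split-bound (suc c) d (suc v) = begin
    h L (suc v) + x * h (x ∷ L) v
      ≤⟨ ℚₚ.+-mono-≤ (h-split-bound c d (suc v)) (*-monoˡ-≤ 0≤x (h-split-bound (suc c) d v)) ⟩
    M (suc v) * S (suc v) + x * (M v * S' v)
      ≤⟨ ℚₚ.+-monoʳ-≤ (M (suc v) * S (suc v))
           (*-monoˡ-≤ 0≤x (*-monoʳ-≤ (partialSum-nonNeg (suc c) v) (multichoose-mono d v))) ⟩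
    M (suc v) * S (suc v) + x * (M (suc v) * S' v)
      ≡⟨ solve 4 (λ M S x S' → M :* S :+ x :* (M :* S') := M :* (S :+ x :* S')) refl (M (suc v)) (S (suc v)) x (S' v) ⟩
    M (suc v) * (S (suc v) + x * S' v) ∎
    where
    open ℚₚ.≤-Reasoning
    L  = replicate c x ++ replicate (suc d) 1ℚ
    M  = multichoose (suc d)
    S  = partialSum c
    S' = partialSum (suc c)

  h-bound : x ≤ 1ℚ → ∀ c d v {ws} → ws ↭ replicate c x ++ replicate (suc d) 1ℚ →
    h ws v * (fromℕ (c ℕ.+ d ℕ.+ v) * (1ℚ - x)) ^ℚ c ≤ fromℕ (c ℕ.+ d) ^ℚ c * multichoose (suc (c ℕ.+ d)) v
  h-bound x≤1 c d v {ws} sorted = begin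
    h ws v * (n * (1ℚ - x)) ^ℚ c
      ≡⟨ cong₂ _*_ (h-↭ sorted v) (*-^ℚ n (1ℚ - x) c) ⟩
    h (replicate c x ++ replicate (suc d) 1ℚ) v * (n ^ℚ c * (1ℚ - x) ^ℚ c)
      ≤⟨ *-monoʳ-≤ (*-nonNeg (^ℚ-nonNeg c (fromℕ-nonNeg _)) (^ℚ-nonNeg c (≤⇒0≤- x≤1))) (h-split-bound c d v) ⟩
    M * partialSum c v * (n ^ℚ c * (1ℚ - x) ^ℚ c)
      ≡⟨ solve 4 (λ M S N Y → M :* S :* (N :* Y) := M :* N :* (Y :* S)) refl M (partialSum c v) (n ^ℚ c) ((1ℚ - x) ^ℚ c) ⟩
    M * n ^ℚ c * ((1ℚ - x) ^ℚ c * partialSum c v)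
      ≤⟨ *-monoˡ-≤ (*-nonNeg (multichoose-nonNeg (suc d) v) (^ℚ-nonNeg c (fromℕ-nonNeg _))) (partialSum-bound x≤1 c v) ⟩
    M * n ^ℚ c * 1ℚ
      ≡⟨ ℚₚ.*-identityʳ _ ⟩
    M * n ^ℚ c
      ≤⟨ multichoose-ratio c d v ⟩
    fromℕ (c ℕ.+ d) ^ℚ c * multichoose (suc (c ℕ.+ d)) v ∎
    where
    open ℚₚ.≤-Reasoning
    n = fromℕ (c ℕ.+ d ℕ.+ v)
    M = multichoose (suc d) v

gapWeight : ℚ → Bool → ℚ
gapWeight x b = if b then x else 1ℚ

gapWeights-↭ : ∀ x {t} (C : Subset t) →
  map (gapWeight x) (toList C) ↭ replicate (∣ C ∣) x ++ replicate (∣ ∁ C ∣) 1ℚ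
gapWeights-↭ x Vec.[]          = ↭.refl
gapWeights-↭ x (true  Vec.∷ C) = ↭.prep x (gapWeights-↭ x C)
gapWeights-↭ x (false Vec.∷ C) = ↭.trans (↭.prep 1ℚ (gapWeights-↭ x C))
  (↭.↭-sym (↭ₚ.shift 1ℚ (replicate (∣ C ∣) x) (replicate (∣ ∁ C ∣) 1ℚ)))

gapWeights-1 : ∀ fs → map (gapWeight 1ℚ) fs ≡ replicate (length fs) 1ℚ
gapWeights-1 []          = refl
gapWeights-1 (true  ∷ fs) = cong (1ℚ ∷_) (gapWeights-1 fs)
gapWeights-1 (false ∷ fs) = cong (1ℚ ∷_) (gapWeights-1 fs)

module ∑ℚ = MonoidSum ℚₚ.+-0-commutativeMonoid
module ∑ℕ = MonoidSum ℕₚ.+-0-commutativeMonoid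

𝟙 : Bool → ℕ
𝟙 b = if b then 1 else 0

count : ∀ {n} → (Fin n → Bool) → ℕ
count P = ∑ℕ.sum (λ a → 𝟙 (P a))

sumℚ-tabulate : ∀ {n} (f : Fin n → ℚ) → sumℚ (tabulate f) ≡ ∑ℚ.sum f
sumℚ-tabulate {zero}  f = refl
sumℚ-tabulate {suc n} f = cong (λ q → f Fin.zero + q) (sumℚ-tabulate (λ i → f (Fin.suc i)))

sumℚ-allFin : ∀ {n} (f : Fin n → ℚ) → sumℚ (map f (allFin n)) ≡ ∑ℚ.sum f
sumℚ-allFin f = trans (cong sumℚ (Listₚ.map-tabulate (λ i → i) f)) (sumℚ-tabulate f)

length-filter-tabulate : ∀ {n} {A : Set} (P : A → Bool) (g : Fin n → A) →
  length (filter (λ a → P a Data.Bool.≟ true) (tabulate g)) ≡ count (λ i → P (g i))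
length-filter-tabulate {zero}  P g = refl
length-filter-tabulate {suc n} P g with P (g Fin.zero)
... | true  = cong suc (length-filter-tabulate P (λ i → g (Fin.suc i)))
... | false = length-filter-tabulate P (λ i → g (Fin.suc i))

∑-indicator : ∀ {n} (P : Fin n → Bool) X → ∑ℚ.sum (λ a → if P a then X else 0ℚ) ≡ fromℕ (count P) * X
∑-indicator {zero}  P X = trans (sym (ℚₚ.*-zeroˡ X)) (cong (_* X) (sym fromℕ-0))
∑-indicator {suc n} P X with P Fin.zero | ∑-indicator (λ i → P (Fin.suc i)) X
... | true  | ih = begin
  X + ∑ℚ.sum (λ a → if P (Fin.suc a) then X else 0ℚ) ≡⟨ cong (λ q → X + q) ih ⟩
  X + fromℕ k * X                       ≡⟨ solve 2 (λ X K → X :+ K :* X := (con 1ℚ :+ K) :* X) refl X (fromℕ k) ⟩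
  (1ℚ + fromℕ k) * X                    ≡⟨ cong (_* X) (sym (fromℕ-suc k)) ⟩
  fromℕ (suc k) * X                     ∎
  where
  open ≡-Reasoning
  k = count (λ i → P (Fin.suc i))
... | false | ih = trans (ℚₚ.+-identityˡ _) ih

∑ℕ-point : ∀ {n} (a : Fin n) (b : ℕ) → ∑ℕ.sum (λ j → if does (a ≟ j) then b else 0) ≡ b
∑ℕ-point {suc n} Fin.zero    b = trans (cong (b ℕ.+_) (∑ℕ.sum-replicate-zero n)) (ℕₚ.+-identityʳ b)
∑ℕ-point {suc n} (Fin.suc a) b = ∑ℕ-point a b

count-remove : ∀ {n} (P : Fin n → Bool) a → count P ≡ 𝟙 (P a) ℕ.+ count (λ y → P y ∧ not (does (a ≟ y)))
count-remove {n} P a = begin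
  count P                                          ≡⟨ ∑ℕ.sum-cong-≗ split ⟩
  ∑ℕ.sum (λ y → point y ℕ.+ rest y)                ≡⟨ ∑ℕ.∑-distrib-+ point rest ⟩
  ∑ℕ.sum point ℕ.+ ∑ℕ.sum rest                     ≡⟨ cong (ℕ._+ ∑ℕ.sum rest) (∑ℕ-point a (𝟙 (P a))) ⟩
  𝟙 (P a) ℕ.+ ∑ℕ.sum rest                          ∎
  where
  open ≡-Reasoning
  point rest : Fin n → ℕ
  point y = if does (a ≟ y) then 𝟙 (P a) else 0
  rest  y = 𝟙 (P y ∧ not (does (a ≟ y)))
  split : ∀ y → 𝟙 (P y) ≡ point y ℕ.+ rest y
  split y with a ≟ y
  ... | yes refl = sym (trans (cong (λ b → 𝟙 (P a) ℕ.+ 𝟙 b) (Boolₚ.∧-zeroʳ (P a))) (ℕₚ.+-identityʳ _))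
  ... | no _     = cong 𝟙 (sym (Boolₚ.∧-identityʳ (P y)))

not-∨-∧ : ∀ d e q → not (d ∨ e) ∧ q ≡ (not d ∧ q) ∧ not e
not-∨-∧ true  e     q = refl
not-∨-∧ false true  q = sym (Boolₚ.∧-zeroʳ q)
not-∨-∧ false false q = sym (Boolₚ.∧-identityʳ q)

insert : ∀ {n} → (Fin n → Bool) → Fin n → Fin n → Bool
insert D a y = D y ∨ does (a ≟ y)

count-insert : ∀ {n} (D Q : Fin n → Bool) a → D a ≡ false →
  count (λ y → not (D y) ∧ Q y) ≡ 𝟙 (Q a) ℕ.+ count (λ y → not (insert D a y) ∧ Q y)
count-insert D Q a Da≡false = begin
  count (λ y → not (D y) ∧ Q y)
    ≡⟨ count-remove (λ y → not (D y) ∧ Q y) a ⟩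
  𝟙 (not (D a) ∧ Q a) ℕ.+ count (λ y → (not (D y) ∧ Q y) ∧ not (does (a ≟ y)))
    ≡⟨ cong₂ (λ d c → 𝟙 (not d ∧ Q a) ℕ.+ c) Da≡false
             (∑ℕ.sum-cong-≗ (λ y → cong 𝟙 (sym (not-∨-∧ (D y) (does (a ≟ y)) (Q y))))) ⟩
  𝟙 (Q a) ℕ.+ count (λ y → not (insert D a y) ∧ Q y) ∎
  where open ≡-Reasoning

memb-suc : ∀ {n} b (I : Subset n) i → memb (Fin.suc i) (b Vec.∷ I) ≡ memb i I
memb-suc b I i with i Subsetₚ.∈? I
... | yes _ = refl
... | no _  = refl

count-∈ : ∀ {n} (I : Subset n) → count (λ a → memb a I) ≡ ∣ I ∣
count-∈ Vec.[]          = refl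
count-∈ (true  Vec.∷ I) = cong suc (trans (∑ℕ.sum-cong-≗ (λ a → cong 𝟙 (memb-suc true I a))) (count-∈ I))
count-∈ (false Vec.∷ I) = trans (∑ℕ.sum-cong-≗ (λ a → cong 𝟙 (memb-suc false I a))) (count-∈ I)

count-∉ : ∀ {n} (I : Subset n) → count (λ a → not (memb a I)) ≡ ∣ ∁ I ∣
count-∉ Vec.[]          = refl
count-∉ (true  Vec.∷ I) = trans (∑ℕ.sum-cong-≗ (λ a → cong (𝟙 ∘ not) (memb-suc true I a))) (count-∉ I)
count-∉ (false Vec.∷ I) = cong suc (trans (∑ℕ.sum-cong-≗ (λ a → cong (𝟙 ∘ not) (memb-suc false I a))) (count-∉ I))

sumℚ-++ : ∀ xs ys → sumℚ (xs ++ ys) ≡ sumℚ xs + sumℚ ys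
sumℚ-++ []       ys = sym (ℚₚ.+-identityˡ _)
sumℚ-++ (x ∷ xs) ys = trans (cong (λ q → x + q) (sumℚ-++ xs ys)) (sym (ℚₚ.+-assoc x _ _))

sumℚ-concat : ∀ xss → sumℚ (List.concat xss) ≡ sumℚ (map sumℚ xss)
sumℚ-concat []         = refl
sumℚ-concat (xs ∷ xss) = trans (sumℚ-++ xs _) (cong (λ q → sumℚ xs + q) (sumℚ-concat xss))

sumℚ-scale : ∀ {A : Set} k (f : A → ℚ) xs → sumℚ (map (λ a → k * f a) xs) ≡ k * sumℚ (map f xs)
sumℚ-scale k f []       = sym (ℚₚ.*-zeroʳ k)
sumℚ-scale k f (x ∷ xs) = trans (cong (λ q → k * f x + q) (sumℚ-scale k f xs)) (sym (ℚₚ.*-distribˡ-+ k (f x) _))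

sumℚ-zero : ∀ {A : Set} (xs : List A) → sumℚ (map (λ _ → 0ℚ) xs) ≡ 0ℚ
sumℚ-zero []       = refl
sumℚ-zero (x ∷ xs) = trans (ℚₚ.+-identityˡ _) (sumℚ-zero xs)

sumℚ-filter : ∀ {A : Set} {P : A → Set} (P? : ∀ a → Dec (P a)) (f : A → ℚ) xs →
  sumℚ (map f (filter P? xs)) ≡ sumℚ (map (λ a → if does (P? a) then f a else 0ℚ) xs)
sumℚ-filter P? f []       = refl
sumℚ-filter P? f (x ∷ xs) with does (P? x)
... | true  = cong (λ q → f x + q) (sumℚ-filter P? f xs)
... | false = trans (sumℚ-filter P? f xs) (sym (ℚₚ.+-identityˡ _))

sumℚ-words-suc : ∀ n m (g : Vec (Fin n) (suc m) → ℚ) →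
  sumℚ (map g (words n (suc m))) ≡ ∑ℚ.sum (λ a → sumℚ (map (λ w → g (a Vec.∷ w)) (words n m)))
sumℚ-words-suc n m g = begin
  sumℚ (map g (List.concatMap (λ a → map (a Vec.∷_) (words n m)) (allFin n)))
    ≡⟨ cong sumℚ (Listₚ.map-concatMap g _ (allFin n)) ⟩
  sumℚ (List.concat (map (λ a → map g (map (a Vec.∷_) (words n m))) (allFin n)))
    ≡⟨ sumℚ-concat (map (λ a → map g (map (a Vec.∷_) (words n m))) (allFin n)) ⟩
  sumℚ (map sumℚ (map (λ a → map g (map (a Vec.∷_) (words n m))) (allFin n)))
    ≡⟨ cong sumℚ (trans (sym (Listₚ.map-∘ (allFin n)))
                        (Listₚ.map-cong (λ a → cong sumℚ (sym (Listₚ.map-∘ (words n m)))) (allFin n))) ⟩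
  sumℚ (map (λ a → sumℚ (map (λ w → g (a Vec.∷ w)) (words n m))) (allFin n))
    ≡⟨ sumℚ-allFin (λ a → sumℚ (map (λ w → g (a Vec.∷ w)) (words n m))) ⟩
  ∑ℚ.sum (λ a → sumℚ (map (λ w → g (a Vec.∷ w)) (words n m))) ∎
  where open ≡-Reasoning

-- Weighted sums over injective words

current : List Bool → Bool
current []      = false
current (b ∷ _) = b

-- Reading a word from left to right, fs holds the flags of the gaps from the current one
-- on: a letter of I closes the current gap, any other letter is counted iff the current gap
-- is flagged.
gapCount : ∀ {n m} → Subset n → List Bool → Vec (Fin n) m → ℕ
gapCount I fs Vec.[]       = 0
gapCount I fs (a Vec.∷ w) =
  if memb a I then gapCount I (List.drop 1 fs) w else 𝟙 (current fs) ℕ.+ gapCount I fs w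

distinct : ∀ {n m} → Vec (Fin n) m → Bool
distinct w = does (UniqueDec.unique? _≟_ (toList w))

fresh : ∀ {n m} → Fin n → Vec (Fin n) m → Bool
fresh a w = does (All.all? (λ y → ¬? (a ≟ y)) (toList w))

avoids : ∀ {n m} → (Fin n → Bool) → Vec (Fin n) m → Bool
avoids D Vec.[]       = true
avoids D (a Vec.∷ w) = not (D a) ∧ avoids D w

avoids-none : ∀ {n m} (w : Vec (Fin n) m) → avoids (λ _ → false) w ≡ true
avoids-none Vec.[]       = refl
avoids-none (a Vec.∷ w) = avoids-none w

avoids-insert : ∀ {n m} D a (w : Vec (Fin n) m) →
  fresh a w ∧ avoids D w ≡ avoids (insert D a) w
avoids-insert D a Vec.[]       = refl
avoids-insert D a (y Vec.∷ w) rewrite sym (avoids-insert D a w) with does (a ≟ y) | D y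
... | true  | true  = refl
... | true  | false = refl
... | false | true  = Boolₚ.∧-zeroʳ _
... | false | false = refl

∧-shuffle : ∀ N U d V → (N ∧ U) ∧ (not d ∧ V) ≡ not d ∧ (U ∧ (N ∧ V))
∧-shuffle N     U true  V = Boolₚ.∧-zeroʳ (N ∧ U)
∧-shuffle true  U false V = refl
∧-shuffle false U false V = sym (Boolₚ.∧-zeroʳ U)

distinct-avoids-∷ : ∀ {n m} D a (w : Vec (Fin n) m) →
  distinct (a Vec.∷ w) ∧ avoids D (a Vec.∷ w) ≡ not (D a) ∧ (distinct w ∧ avoids (insert D a) w)
distinct-avoids-∷ D a w =
  trans (∧-shuffle (fresh a w) (distinct w) (D a) (avoids D w))
        (cong (λ b → not (D a) ∧ (distinct w ∧ b)) (avoids-insert D a w))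

-- The first letter of an injective word with u letters of I and v others to place is one
-- of the u, closing the current gap, or one of the v, weighted by the current gap.
arrangements-step : ∀ u v w ws → length ws ≡ u → u ℕ.+ v ≢ 0 →
  fromℕ u * (fromℕ (pred u !) * fromℕ (v !) * h ws v)
    + fromℕ v * (w * (fromℕ (u !) * fromℕ (pred v !) * h (w ∷ ws) (pred v)))
  ≡ fromℕ (u !) * fromℕ (v !) * h (w ∷ ws) v
arrangements-step zero    zero    w ws len u+v≢0 = contradiction refl u+v≢0
arrangements-step zero    (suc v) w [] len u+v≢0
  rewrite fromℕ-0 | fromℕ-1 | fromℕ-! v | fromℕ-suc v =
  solve 5 (λ X V V! w B → con 0ℚ :* X :+ (con 1ℚ :+ V) :* (w :* (con 1ℚ :* V! :* B))
                          := con 1ℚ :* ((con 1ℚ :+ V) :* V!) :* (con 0ℚ :+ w :* B))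
    refl (1ℚ * ((1ℚ + fromℕ v) * fromℕ (v !)) * 0ℚ) (fromℕ v) (fromℕ (v !)) w (h (w ∷ []) v)
arrangements-step (suc u) zero    w ws len u+v≢0
  rewrite fromℕ-0 | fromℕ-1 | fromℕ-! u | fromℕ-suc u =
  solve 3 (λ U U! w → (con 1ℚ :+ U) :* (U! :* con 1ℚ :* con 1ℚ)
                        :+ con 0ℚ :* (w :* ((con 1ℚ :+ U) :* U! :* con 1ℚ :* con 1ℚ))
                      := (con 1ℚ :+ U) :* U! :* con 1ℚ :* con 1ℚ)
    refl (fromℕ u) (fromℕ (u !)) w
arrangements-step (suc u) (suc v) w ws len u+v≢0
  rewrite fromℕ-! u | fromℕ-! v | fromℕ-suc u | fromℕ-suc v =
  solve 7 (λ U U! V V! w A B →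
             (con 1ℚ :+ U) :* (U! :* ((con 1ℚ :+ V) :* V!) :* A) :+ (con 1ℚ :+ V) :* (w :* ((con 1ℚ :+ U) :* U! :* V! :* B))
             := (con 1ℚ :+ U) :* U! :* ((con 1ℚ :+ V) :* V!) :* (A :+ w :* B))
    refl (fromℕ u) (fromℕ (u !)) (fromℕ v) (fromℕ (v !)) w (h ws (suc v)) (h (w ∷ ws) v)

module InjectiveWords (x : ℚ) {n : ℕ} (I : Subset n) where

  wordWeight : ∀ {m} → (Fin n → Bool) → List Bool → Vec (Fin n) m → ℚ
  wordWeight D fs w = if distinct w ∧ avoids D w then x ^ℚ gapCount I fs w else 0ℚ

  weightedSum : (Fin n → Bool) → ℕ → List Bool → ℚ
  weightedSum D m fs = sumℚ (map (wordWeight D fs) (words n m))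

  ^ℚ-𝟙+ : ∀ b k → x ^ℚ (𝟙 b ℕ.+ k) ≡ gapWeight x b * x ^ℚ k
  ^ℚ-𝟙+ true  k = refl
  ^ℚ-𝟙+ false k = sym (ℚₚ.*-identityˡ _)

  firstLetterSum : (Fin n → Bool) → ℕ → List Bool → Fin n → ℚ
  firstLetterSum D m fs a =
    if memb a I then weightedSum (insert D a) m (List.drop 1 fs)
    else gapWeight x (current fs) * weightedSum (insert D a) m fs

  afterFirst : ∀ {m} → (Fin n → Bool) → List Bool → Fin n → Vec (Fin n) m → ℚ
  afterFirst D fs a w =
    if memb a I then wordWeight (insert D a) (List.drop 1 fs) w
    else gapWeight x (current fs) * wordWeight (insert D a) fs w

  wordWeight-∷ : ∀ {m} D fs a (w : Vec (Fin n) m) →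
    wordWeight D fs (a Vec.∷ w) ≡ (if D a then 0ℚ else afterFirst D fs a w)
  wordWeight-∷ D fs a w rewrite distinct-avoids-∷ D a w with D a
  ... | true  = refl
  ... | false with memb a I | distinct w ∧ avoids (insert D a) w
  ...   | true  | _     = refl
  ...   | false | true  = ^ℚ-𝟙+ (current fs) (gapCount I fs w)
  ...   | false | false = sym (ℚₚ.*-zeroʳ (gapWeight x (current fs)))

  weightedSum-suc : ∀ D m fs →
    weightedSum D (suc m) fs ≡ ∑ℚ.sum (λ a → if D a then 0ℚ else firstLetterSum D m fs a)
  weightedSum-suc D m fs = trans (sumℚ-words-suc n m (wordWeight D fs)) (∑ℚ.sum-cong-≗ first-letter)
    where
    first-letter : ∀ a → sumℚ (map (λ w → wordWeight D fs (a Vec.∷ w)) (words n m))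
                         ≡ (if D a then 0ℚ else firstLetterSum D m fs a)
    first-letter a = trans (cong sumℚ (Listₚ.map-cong (wordWeight-∷ D fs a) (words n m))) (used (D a))
      where
      used : ∀ d → sumℚ (map (λ w → if d then 0ℚ else afterFirst D fs a w) (words n m))
                   ≡ (if d then 0ℚ else firstLetterSum D m fs a)
      used true  = sumℚ-zero (words n m)
      used false with memb a I
      ... | true  = refl
      ... | false = sumℚ-scale (gapWeight x (current fs)) (wordWeight (insert D a) fs) (words n m)

  ClosedForm : ℕ → Set
  ClosedForm m = ∀ D fs u v →
    count (λ a → not (D a) ∧ memb a I) ≡ u → count (λ a → not (D a) ∧ not (memb a I)) ≡ v →
    m ≡ u ℕ.+ v → length fs ≡ suc u →
    weightedSum D m fs ≡ fromℕ (u !) * fromℕ (v !) * h (map (gapWeight x) fs) v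

  closedForm-zero : ClosedForm 0
  closedForm-zero D fs zero zero _ _ _ _ rewrite fromℕ-1 = refl

  closedForm-after-I : ∀ {m} → ClosedForm m → ∀ D f fs u v a →
    count (λ a → not (D a) ∧ memb a I) ≡ u → count (λ a → not (D a) ∧ not (memb a I)) ≡ v →
    suc m ≡ u ℕ.+ v → length (f ∷ fs) ≡ suc u → D a ≡ false → memb a I ≡ true →
    weightedSum (insert D a) m fs ≡ fromℕ (pred u !) * fromℕ (v !) * h (map (gapWeight x) fs) v
  closedForm-after-I {m} ih D f fs u v a hu hv hm hl a∉D a∈I = begin
    weightedSum (insert D a) m fs
      ≡⟨ ih (insert D a) fs u' v refl hv' (ℕₚ.suc-injective (trans hm (cong (ℕ._+ v) u≡1+u')))
                                           (trans (ℕₚ.suc-injective hl) u≡1+u') ⟩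
    fromℕ (u' !) * fromℕ (v !) * h (map (gapWeight x) fs) v
      ≡⟨ cong (λ k → fromℕ (pred k !) * fromℕ (v !) * h (map (gapWeight x) fs) v) (sym u≡1+u') ⟩
    fromℕ (pred u !) * fromℕ (v !) * h (map (gapWeight x) fs) v ∎
    where
    open ≡-Reasoning
    u' = count (λ y → not (insert D a y) ∧ memb y I)
    u≡1+u' : u ≡ suc u'
    u≡1+u' = trans (sym hu) (trans (count-insert D (λ y → memb y I) a a∉D) (cong (λ b → 𝟙 b ℕ.+ u') a∈I))
    hv' : count (λ y → not (insert D a y) ∧ not (memb y I)) ≡ v
    hv' = trans (cong (λ b → 𝟙 (not b) ℕ.+ count (λ y → not (insert D a y) ∧ not (memb y I))) (sym a∈I))
                (trans (sym (count-insert D (λ y → not (memb y I)) a a∉D)) hv)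

  closedForm-after-∉I : ∀ {m} → ClosedForm m → ∀ D fs u v a →
    count (λ a → not (D a) ∧ memb a I) ≡ u → count (λ a → not (D a) ∧ not (memb a I)) ≡ v →
    suc m ≡ u ℕ.+ v → length fs ≡ suc u → D a ≡ false → memb a I ≡ false →
    weightedSum (insert D a) m fs ≡ fromℕ (u !) * fromℕ (pred v !) * h (map (gapWeight x) fs) (pred v)
  closedForm-after-∉I {m} ih D fs u v a hu hv hm hl a∉D a∉I = begin
    weightedSum (insert D a) m fs
      ≡⟨ ih (insert D a) fs u v' hu' refl (ℕₚ.suc-injective (trans hm (trans (cong (u ℕ.+_) v≡1+v') (ℕₚ.+-suc u v')))) hl ⟩
    fromℕ (u !) * fromℕ (v' !) * h (map (gapWeight x) fs) v'
      ≡⟨ cong (λ k → fromℕ (u !) * fromℕ (pred k !) * h (map (gapWeight x) fs) (pred k)) (sym v≡1+v') ⟩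
    fromℕ (u !) * fromℕ (pred v !) * h (map (gapWeight x) fs) (pred v) ∎
    where
    open ≡-Reasoning
    v' = count (λ y → not (insert D a y) ∧ not (memb y I))
    v≡1+v' : v ≡ suc v'
    v≡1+v' = trans (sym hv) (trans (count-insert D (λ y → not (memb y I)) a a∉D) (cong (λ b → 𝟙 (not b) ℕ.+ v') a∉I))
    hu' : count (λ y → not (insert D a y) ∧ memb y I) ≡ u
    hu' = trans (cong (λ b → 𝟙 b ℕ.+ count (λ y → not (insert D a y) ∧ memb y I)) (sym a∉I))
                (trans (sym (count-insert D (λ y → memb y I) a a∉D)) hu)

  closedForm-suc : ∀ {m} → ClosedForm m → ClosedForm (suc m)
  closedForm-suc ih D []       u v hu hv hm ()
  closedForm-suc {m} ih D (f ∷ fs) u v hu hv hm hl = begin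
    weightedSum D (suc m) (f ∷ fs)
      ≡⟨ weightedSum-suc D m (f ∷ fs) ⟩
    ∑ℚ.sum (λ a → if D a then 0ℚ else firstLetterSum D m (f ∷ fs) a)
      ≡⟨ ∑ℚ.sum-cong-≗ split ⟩
    ∑ℚ.sum (λ a → (if inI a then X else 0ℚ) + (if notI a then w₀ * Y else 0ℚ))
      ≡⟨ ∑ℚ.∑-distrib-+ (λ a → if inI a then X else 0ℚ) (λ a → if notI a then w₀ * Y else 0ℚ) ⟩
    ∑ℚ.sum (λ a → if inI a then X else 0ℚ) + ∑ℚ.sum (λ a → if notI a then w₀ * Y else 0ℚ)
      ≡⟨ cong₂ _+_ (∑-indicator inI X) (∑-indicator notI (w₀ * Y)) ⟩
    fromℕ (count inI) * X + fromℕ (count notI) * (w₀ * Y)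
      ≡⟨ cong₂ (λ p q → fromℕ p * X + fromℕ q * (w₀ * Y)) hu hv ⟩
    fromℕ u * X + fromℕ v * (w₀ * Y)
      ≡⟨ arrangements-step u v w₀ (map (gapWeight x) fs)
           (trans (Listₚ.length-map (gapWeight x) fs) (ℕₚ.suc-injective hl))
           (λ u+v≡0 → ℕₚ.1+n≢0 (trans hm u+v≡0)) ⟩
    fromℕ (u !) * fromℕ (v !) * h (map (gapWeight x) (f ∷ fs)) v ∎
    where
    open ≡-Reasoning
    inI notI : Fin n → Bool
    inI  a = not (D a) ∧ memb a I
    notI a = not (D a) ∧ not (memb a I)
    w₀ = gapWeight x f
    X  = fromℕ (pred u !) * fromℕ (v !) * h (map (gapWeight x) fs) v
    Y  = fromℕ (u !) * fromℕ (pred v !) * h (map (gapWeight x) (f ∷ fs)) (pred v)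
    split : ∀ a → (if D a then 0ℚ else firstLetterSum D m (f ∷ fs) a)
                ≡ (if inI a then X else 0ℚ) + (if notI a then w₀ * Y else 0ℚ)
    split a with D a in eqD | memb a I in eqI
    ... | true  | _     = sym (ℚₚ.+-identityˡ 0ℚ)
    ... | false | true  =
      trans (closedForm-after-I ih D f fs u v a hu hv hm hl eqD eqI) (sym (ℚₚ.+-identityʳ X))
    ... | false | false =
      trans (cong (w₀ *_) (closedForm-after-∉I ih D (f ∷ fs) u v a hu hv hm hl eqD eqI))
            (sym (ℚₚ.+-identityˡ (w₀ * Y)))

  weightedSum≡h : ∀ m → ClosedForm m
  weightedSum≡h zero    = closedForm-zero
  weightedSum≡h (suc m) = closedForm-suc (weightedSum≡h m)

-- Letters and positions in a permutation

occurs : ∀ {n m} → Fin n → Vec (Fin n) m → Bool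
occurs j Vec.[]      = false
occurs j (y Vec.∷ w) = does (y ≟ j) ∨ occurs j w

∧-true : ∀ {a b} → a ∧ b ≡ true → a ≡ true × b ≡ true
∧-true {true} {true} _ = refl , refl

does-refl : ∀ {n} (a : Fin n) → does (a ≟ a) ≡ true
does-refl a = dec-true (a ≟ a) refl

does-sym : ∀ {n} (a b : Fin n) → does (a ≟ b) ≡ does (b ≟ a)
does-sym a b with a ≟ b | b ≟ a
... | yes _  | yes _  = refl
... | no _   | no _   = refl
... | yes eq | no neq = contradiction (sym eq) neq
... | no neq | yes eq = contradiction (sym eq) neq

fresh⇒¬occurs : ∀ {n m} a (w : Vec (Fin n) m) → fresh a w ≡ true → occurs a w ≡ false
fresh⇒¬occurs a Vec.[]      _ = refl
fresh⇒¬occurs a (y Vec.∷ w) h with a ≟ y in a≟y | ∧-true {does (¬? (a ≟ y))} h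
... | no _ | _ , h₂ rewrite does-sym y a | a≟y = fresh⇒¬occurs a w h₂

occurs-lookup : ∀ {n m} (w : Vec (Fin n) m) p → occurs (Vec.lookup w p) w ≡ true
occurs-lookup (y Vec.∷ w) Fin.zero    rewrite does-refl y = refl
occurs-lookup (y Vec.∷ w) (Fin.suc p) rewrite occurs-lookup w p = Boolₚ.∨-zeroʳ _

head-≢-lookup : ∀ {n m} y (w : Vec (Fin n) m) p → distinct (y Vec.∷ w) ≡ true → does (y ≟ Vec.lookup w p) ≡ false
head-≢-lookup y w p h with y ≟ Vec.lookup w p
... | no _       = refl
... | yes y≡w[p] = contradiction (trans (sym (fresh⇒¬occurs y w (proj₁ (∧-true {fresh y w} h))))
                                        (subst (λ z → occurs z w ≡ true) (sym y≡w[p]) (occurs-lookup w p))) λ ()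

lookup-injective : ∀ {n m} (w : Vec (Fin n) m) → distinct w ≡ true → ∀ p q → Vec.lookup w p ≡ Vec.lookup w q → p ≡ q
lookup-injective (y Vec.∷ w) h Fin.zero    Fin.zero    _ = refl
lookup-injective (y Vec.∷ w) h Fin.zero    (Fin.suc q) e =
  contradiction (trans (sym (head-≢-lookup y w q h)) (dec-true (y ≟ Vec.lookup w q) e)) λ ()
lookup-injective (y Vec.∷ w) h (Fin.suc p) Fin.zero    e =
  contradiction (trans (sym (head-≢-lookup y w p h)) (dec-true (y ≟ Vec.lookup w p) (sym e))) λ ()
lookup-injective (y Vec.∷ w) h (Fin.suc p) (Fin.suc q) e =
  cong Fin.suc (lookup-injective w (proj₂ (∧-true {fresh y w} h)) p q e)

injective⇒surjective : ∀ {N} (f : Fin N → Fin N) → (∀ p q → f p ≡ f q → p ≡ q) → ∀ j → ∃ λ p → f p ≡ j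
injective⇒surjective {suc N} f inj j with Finₚ.any? (λ p → f p ≟ j)
... | yes found = found
... | no ¬found = contradiction (Finₚ.injective⇒≤ punchOut-injective) ℕₚ.1+n≰n
  where
  missed : ∀ p → j ≢ f p
  missed p j≡fp = ¬found (p , sym j≡fp)
  punchOut-injective : ∀ {p q} → Fin.punchOut (missed p) ≡ Fin.punchOut (missed q) → p ≡ q
  punchOut-injective {p} {q} e = inj p q (Finₚ.punchOut-injective (missed p) (missed q) e)

occurs-permutation : ∀ {n} (π : Vec (Fin n) n) → distinct π ≡ true → ∀ j → occurs j π ≡ true
occurs-permutation π h j with injective⇒surjective (Vec.lookup π) (lookup-injective π h) j
... | p , refl = occurs-lookup π p

posOf-lookup : ∀ {n m} (w : Vec (Fin n) m) → distinct w ≡ true → ∀ p → posOf w (Vec.lookup w p) ≡ suc (toℕ p)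
posOf-lookup (y Vec.∷ w) h Fin.zero with y ≟ y
... | yes _   = refl
... | no y≢y = contradiction refl y≢y
posOf-lookup (y Vec.∷ w) h (Fin.suc p) with y ≟ Vec.lookup w p in y≟w[p]
... | yes _ = contradiction (trans (sym (head-≢-lookup y w p h)) (cong does y≟w[p])) λ ()
... | no _  = cong suc (posOf-lookup w (proj₂ (∧-true {fresh y w} h)) p)

-- The number of letters of I before j, i.e. the index k of the gap J_k containing j.
gapIndex : ∀ {n m} → Subset n → Vec (Fin n) m → Fin n → ℕ
gapIndex I Vec.[]      j = 0
gapIndex I (y Vec.∷ w) j = if does (y ≟ j) then 0 else 𝟙 (memb y I) ℕ.+ gapIndex I w j

countBefore : ∀ {N} → (Fin N → Bool) → Fin N → ℕ
countBefore Q Fin.zero    = 0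
countBefore Q (Fin.suc p) = 𝟙 (Q Fin.zero) ℕ.+ countBefore (λ i → Q (Fin.suc i)) p

gapIndex-lookup : ∀ {n m} (I : Subset n) (w : Vec (Fin n) m) → distinct w ≡ true →
  ∀ p → gapIndex I w (Vec.lookup w p) ≡ countBefore (λ q → memb (Vec.lookup w q) I) p
gapIndex-lookup I (y Vec.∷ w) h Fin.zero    rewrite does-refl y = refl
gapIndex-lookup I (y Vec.∷ w) h (Fin.suc p) rewrite head-≢-lookup y w p h =
  cong (𝟙 (memb y I) ℕ.+_) (gapIndex-lookup I w (proj₂ (∧-true {fresh y w} h)) p)

positions : (N o : ℕ) → (Fin N → Bool) → List ℕ
positions zero    o Q = []
positions (suc N) o Q =
  if Q Fin.zero then suc o ∷ rest else rest
  where rest = positions N (suc o) (λ i → Q (Fin.suc i))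

positions-> : ∀ N o Q → All (o ℕ.<_) (positions N o Q)
positions-> zero    o Q = All.[]
positions-> (suc N) o Q with Q Fin.zero
... | true  = ℕₚ.n<1+n o All.∷ All.map (ℕₚ.<-trans (ℕₚ.n<1+n o)) (positions-> N (suc o) _)
... | false = All.map (ℕₚ.<-trans (ℕₚ.n<1+n o)) (positions-> N (suc o) _)

positions-cong : ∀ N o {Q Q' : Fin N → Bool} → (∀ i → Q i ≡ Q' i) → positions N o Q ≡ positions N o Q'
positions-cong zero    o eq = refl
positions-cong (suc N) o {Q} {Q'} eq
  rewrite eq Fin.zero | positions-cong N (suc o) {λ i → Q (Fin.suc i)} {λ i → Q' (Fin.suc i)} (λ i → eq (Fin.suc i)) = refl

positions-filter : ∀ {N'} N (g : Fin N → Fin N') {P : Fin N' → Set} (P? : ∀ x → Dec (P x)) o →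
  (∀ i → toℕ (g i) ≡ o ℕ.+ toℕ i) →
  map (λ p → suc (toℕ p)) (filter P? (tabulate g)) ≡ positions N o (λ i → does (P? (g i)))
positions-filter zero    g P? o g≡ = refl
positions-filter (suc N) g P? o g≡ with does (P? (g Fin.zero))
... | true  = cong₂ _∷_ (cong suc (trans (g≡ Fin.zero) (ℕₚ.+-identityʳ o))) rest
  where rest = positions-filter N (λ i → g (Fin.suc i)) P? (suc o) (λ i → trans (g≡ (Fin.suc i)) (ℕₚ.+-suc o (toℕ i)))
... | false = positions-filter N (λ i → g (Fin.suc i)) P? (suc o) (λ i → trans (g≡ (Fin.suc i)) (ℕₚ.+-suc o (toℕ i)))

posI≡positions : ∀ {n} (I : Subset n) (π : Vec (Fin n) n) → posI I π ≡ positions n 0 (λ p → memb (Vec.lookup π p) I)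
posI≡positions {n} I π =
  trans (positions-filter n (λ i → i) (λ p → Vec.lookup π p Subsetₚ.∈? I) 0 (λ i → refl))
        (positions-cong n 0 (λ i → sym (isYes≗does (Vec.lookup π i Subsetₚ.∈? I))))

<ᵇ-true : ∀ m n → m ℕ.< n → (m <ᵇ n) ≡ true
<ᵇ-true zero    (suc n) _           = refl
<ᵇ-true (suc m) (suc n) (ℕ.s≤s m<n) = <ᵇ-true m n m<n

<ᵇ-false : ∀ m n → n ℕ.≤ m → (m <ᵇ n) ≡ false
<ᵇ-false m       zero    _           = refl
<ᵇ-false (suc m) (suc n) (ℕ.s≤s n≤m) = <ᵇ-false m n n≤m

not-between : ∀ P (M : List ℕ) → All (P ℕ.<_) M → ∀ k → (nth M k <ᵇ P) ∧ (P <ᵇ nth M (suc k)) ≡ false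
not-between P []      _               k       = Boolₚ.∧-zeroʳ _
not-between P (m ∷ M) (P<m All.∷ _)   zero    rewrite <ᵇ-false m P (ℕₚ.<⇒≤ P<m) = refl
not-between P (m ∷ M) (_ All.∷ P<M)   (suc k) = not-between P M P<M k

below-first : ∀ P (L : List ℕ) E → All (P ℕ.<_) L → P ℕ.< E → (P <ᵇ nth (L ++ E ∷ []) 0) ≡ true
below-first P []      E _             P<E = <ᵇ-true P E P<E
below-first P (l ∷ L) E (P<l All.∷ _) _   = <ᵇ-true P l P<l

position-gap : ∀ N o (Q : Fin N → Bool) p₀ b E P k → Q p₀ ≡ false → b ℕ.≤ o → o ℕ.+ N ℕ.< E →
  P ≡ o ℕ.+ suc (toℕ p₀) →
  (nth (b ∷ (positions N o Q ++ E ∷ [])) k <ᵇ P) ∧ (P <ᵇ nth (positions N o Q ++ E ∷ []) k) ≡ (k ≡ᵇ countBefore Q p₀)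
position-gap (suc N) o Q Fin.zero b E P k Qp₀ b≤o o+N<E refl
  rewrite Qp₀ | ℕₚ.+-comm o 1 = at-p₀ k
  where
  1+o<E : suc o ℕ.< E
  1+o<E = ℕₚ.≤-<-trans (subst (ℕ._≤ o ℕ.+ suc N) (ℕₚ.+-comm o 1) (ℕₚ.+-monoʳ-≤ o (ℕ.s≤s ℕ.z≤n))) o+N<E
  P<rest : All (suc o ℕ.<_) (positions N (suc o) (λ i → Q (Fin.suc i)) ++ E ∷ [])
  P<rest = Allₚ.++⁺ (positions-> N (suc o) _) (1+o<E All.∷ All.[])
  at-p₀ : ∀ k → (nth (b ∷ (positions N (suc o) (λ i → Q (Fin.suc i)) ++ E ∷ [])) k <ᵇ suc o)
                ∧ (suc o <ᵇ nth (positions N (suc o) (λ i → Q (Fin.suc i)) ++ E ∷ []) k) ≡ (k ≡ᵇ 0)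
  at-p₀ zero    rewrite <ᵇ-true b (suc o) (ℕ.s≤s b≤o) =
    below-first (suc o) (positions N (suc o) (λ i → Q (Fin.suc i))) E (positions-> N (suc o) _) 1+o<E
  at-p₀ (suc k) = not-between (suc o) _ P<rest k
position-gap (suc N) o Q (Fin.suc p) b E P k Qp₀ b≤o o+N<E P≡ with Q Fin.zero
... | true  = shifted k
  where
  P≡' : P ≡ suc o ℕ.+ suc (toℕ p)
  P≡' = trans P≡ (ℕₚ.+-suc o (suc (toℕ p)))
  shifted : ∀ k → (nth (b ∷ (suc o ∷ (positions N (suc o) (λ i → Q (Fin.suc i)) ++ E ∷ []))) k <ᵇ P)
                  ∧ (P <ᵇ nth (suc o ∷ (positions N (suc o) (λ i → Q (Fin.suc i)) ++ E ∷ [])) k)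
                ≡ (k ≡ᵇ suc (countBefore (λ i → Q (Fin.suc i)) p))
  shifted zero    rewrite <ᵇ-false P (suc o) (subst (suc o ℕ.≤_) (sym P≡') (ℕₚ.m≤m+n (suc o) _)) = Boolₚ.∧-zeroʳ _
  shifted (suc k) = position-gap N (suc o) (λ i → Q (Fin.suc i)) p (suc o) E P k Qp₀ ℕₚ.≤-refl
                      (subst (ℕ._< E) (ℕₚ.+-suc o N) o+N<E) P≡'
... | false = position-gap N (suc o) (λ i → Q (Fin.suc i)) p b E P k Qp₀ (ℕₚ.m≤n⇒m≤1+n b≤o)
                (subst (ℕ._< E) (ℕₚ.+-suc o N) o+N<E) (trans P≡ (ℕₚ.+-suc o (suc (toℕ p))))

inJ-lookup : ∀ {n} (I : Subset n) (π : Vec (Fin n) n) → distinct π ≡ true →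
  ∀ p₀ → memb (Vec.lookup π p₀) I ≡ false →
  ∀ k → inJ I π k (Vec.lookup π p₀) ≡ (k ≡ᵇ gapIndex I π (Vec.lookup π p₀))
inJ-lookup {n} I π h p₀ p₀∉I k rewrite p₀∉I | gapIndex-lookup I π h p₀ | posI≡positions I π =
  position-gap n 0 (λ p → memb (Vec.lookup π p) I) p₀ 0 (suc n) (posOf π (Vec.lookup π p₀)) k
    p₀∉I ℕ.z≤n ℕₚ.≤-refl (posOf-lookup π h p₀)

anyFin : ∀ {t} → (Fin t → Bool) → Bool
anyFin {zero}  f = false
anyFin {suc t} f = f Fin.zero ∨ anyFin (λ i → f (Fin.suc i))

anyFin-cong : ∀ {t} {f g : Fin t → Bool} → (∀ i → f i ≡ g i) → anyFin f ≡ anyFin g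
anyFin-cong {zero}  eq = refl
anyFin-cong {suc t} eq = cong₂ _∨_ (eq Fin.zero) (anyFin-cong (λ i → eq (Fin.suc i)))

anyFin-false : ∀ {t} {f : Fin t → Bool} → (∀ i → f i ≡ false) → anyFin f ≡ false
anyFin-false {zero}  eq = refl
anyFin-false {suc t} eq rewrite eq Fin.zero = anyFin-false (λ i → eq (Fin.suc i))

or-allFin : ∀ {t} (f : Fin t → Bool) → List.foldr _∨_ false (map f (allFin t)) ≡ anyFin f
or-allFin {t} f = trans (cong (List.foldr _∨_ false) (Listₚ.map-tabulate (λ i → i) f)) (or-tabulate f)
  where
  or-tabulate : ∀ {t} (f : Fin t → Bool) → List.foldr _∨_ false (tabulate f) ≡ anyFin f
  or-tabulate {zero}  f = refl
  or-tabulate {suc t} f = cong (f Fin.zero ∨_) (or-tabulate (λ i → f (Fin.suc i)))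

anyFin-flag : ∀ {t} (C : Subset t) K → anyFin (λ i → memb i C ∧ (toℕ i ≡ᵇ K)) ≡ current (List.drop K (toList C))
anyFin-flag Vec.[]          K       = cong current (sym (Listₚ.drop-[] K))
anyFin-flag (true  Vec.∷ C) zero    = refl
anyFin-flag (false Vec.∷ C) zero    = anyFin-false (λ i → Boolₚ.∧-zeroʳ (memb (Fin.suc i) (false Vec.∷ C)))
anyFin-flag (b     Vec.∷ C) (suc K) =
  trans (cong₂ _∨_ (Boolₚ.∧-zeroʳ (memb Fin.zero (b Vec.∷ C)))
                   (anyFin-cong (λ i → cong (_∧ (toℕ i ≡ᵇ K)) (memb-suc b C i))))
        (anyFin-flag C K)

-- The flags of the gaps J_0, …, J_t: J_0 is never in J_C, and k ∈ C stands for J_{k+1}.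
gapFlags : ∀ {t} → Subset t → List Bool
gapFlags C = false ∷ toList C

anyFin-gapFlag : ∀ {t} (C : Subset t) K →
  anyFin (λ i → memb i C ∧ (suc (toℕ i) ≡ᵇ K)) ≡ current (List.drop K (gapFlags C))
anyFin-gapFlag C zero    = anyFin-false (λ i → Boolₚ.∧-zeroʳ (memb i C))
anyFin-gapFlag C (suc K) = anyFin-flag C K

inJC-gapIndex : ∀ {n t} (I : Subset n) (C : Subset t) (π : Vec (Fin n) n) → distinct π ≡ true →
  ∀ j → inJC I C π j ≡ not (memb j I) ∧ current (List.drop (gapIndex I π j) (gapFlags C))
inJC-gapIndex I C π h j = trans (or-allFin (λ i → memb i C ∧ inJ I π (suc (toℕ i)) j)) (by-membership (memb j I) refl)
  where
  by-membership : ∀ b → memb j I ≡ b →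
    anyFin (λ i → memb i C ∧ inJ I π (suc (toℕ i)) j) ≡ not b ∧ current (List.drop (gapIndex I π j) (gapFlags C))
  by-membership true  j∈I = anyFin-false (λ i → trans (cong (λ b → memb i C ∧ (not b ∧ between (suc (toℕ i)))) j∈I)
                                                      (Boolₚ.∧-zeroʳ (memb i C)))
    where
    between : ℕ → Bool
    between k = (nth (bounds I π) k <ᵇ posOf π j) ∧ (posOf π j <ᵇ nth (bounds I π) (suc k))
  by-membership false j∉I with injective⇒surjective (Vec.lookup π) (lookup-injective π h) j
  ... | p₀ , refl = trans (anyFin-cong (λ i → cong (memb i C ∧_) (inJ-lookup I π h p₀ j∉I (suc (toℕ i)))))
                          (anyFin-gapFlag C (gapIndex I π (Vec.lookup π p₀)))

gapCount-count : ∀ {n m} (I : Subset n) fs (w : Vec (Fin n) m) → distinct w ≡ true →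
  count (λ j → occurs j w ∧ (not (memb j I) ∧ current (List.drop (gapIndex I w j) fs))) ≡ gapCount I fs w
gapCount-count {n} I fs Vec.[]      h = ∑ℕ.sum-replicate-zero n
gapCount-count {n} I fs (a Vec.∷ w) h = begin
  count (λ j → occurs j (a Vec.∷ w) ∧ (not (memb j I) ∧ current (List.drop (gapIndex I (a Vec.∷ w) j) fs)))
    ≡⟨ ∑ℕ.sum-cong-≗ split ⟩
  ∑ℕ.sum (λ j → point j ℕ.+ rest j)
    ≡⟨ ∑ℕ.∑-distrib-+ point rest ⟩
  ∑ℕ.sum point ℕ.+ ∑ℕ.sum rest
    ≡⟨ cong₂ ℕ._+_ (∑ℕ-point a _) (gapCount-count I fs' w (proj₂ (∧-true {fresh a w} h))) ⟩
  𝟙 (not (memb a I) ∧ current fs) ℕ.+ gapCount I fs' w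
    ≡⟨ by-membership (memb a I) ⟩
  gapCount I fs (a Vec.∷ w) ∎
  where
  open ≡-Reasoning
  fs' = if memb a I then List.drop 1 fs else fs
  point rest : Fin n → ℕ
  point j = if does (a ≟ j) then 𝟙 (not (memb a I) ∧ current fs) else 0
  rest  j = 𝟙 (occurs j w ∧ (not (memb j I) ∧ current (List.drop (gapIndex I w j) fs')))
  drop-after : ∀ b K → List.drop (𝟙 b ℕ.+ K) fs ≡ List.drop K (if b then List.drop 1 fs else fs)
  drop-after true  K = sym (Listₚ.drop-drop 1 K fs)
  drop-after false K = refl
  split : ∀ j → 𝟙 (occurs j (a Vec.∷ w) ∧ (not (memb j I) ∧ current (List.drop (gapIndex I (a Vec.∷ w) j) fs)))
              ≡ point j ℕ.+ rest j
  split j with a ≟ j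
  ... | yes refl rewrite fresh⇒¬occurs a w (proj₁ (∧-true {fresh a w} h)) = sym (ℕₚ.+-identityʳ _)
  ... | no _     = cong (λ fs″ → 𝟙 (occurs j w ∧ (not (memb j I) ∧ current fs″))) (drop-after (memb a I) (gapIndex I w j))
  by-membership : ∀ b → 𝟙 (not b ∧ current fs) ℕ.+ gapCount I (if b then List.drop 1 fs else fs) w
                        ≡ (if b then gapCount I (List.drop 1 fs) w else 𝟙 (current fs) ℕ.+ gapCount I fs w)
  by-membership true  = refl
  by-membership false = refl

sizeJC≡gapCount : ∀ {n t} (I : Subset n) (C : Subset t) (π : Vec (Fin n) n) → distinct π ≡ true →
  sizeJC I C π ≡ gapCount I (gapFlags C) π
sizeJC≡gapCount I C π h = begin
  sizeJC I C π
    ≡⟨ length-filter-tabulate (inJC I C π) (λ i → i) ⟩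
  count (inJC I C π)
    ≡⟨ ∑ℕ.sum-cong-≗ (λ j → cong 𝟙 (trans (inJC-gapIndex I C π h j)
                                          (cong (_∧ (not (memb j I) ∧ current (List.drop (gapIndex I π j) (gapFlags C))))
                                                (sym (occurs-permutation π h j))))) ⟩
  count (λ j → occurs j π ∧ (not (memb j I) ∧ current (List.drop (gapIndex I π j) (gapFlags C))))
    ≡⟨ gapCount-count I (gapFlags C) π h ⟩
  gapCount I (gapFlags C) π ∎
  where open ≡-Reasoning

∣p∣+∣∁p∣≡n : ∀ {n} (p : Subset n) → ∣ p ∣ ℕ.+ ∣ ∁ p ∣ ≡ n
∣p∣+∣∁p∣≡n p = trans (cong (∣ p ∣ ℕ.+_) (Subsetₚ.∣∁p∣≡n∸∣p∣ p)) (ℕₚ.m+[n∸m]≡n (Subsetₚ.∣p∣≤n p))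

sum-over-perms : ∀ x {n t} (I : Subset n) (C : Subset t) → ∣ I ∣ ≡ t →
  sumℚ (map (λ π → x ^ℚ sizeJC I C π) (perms n))
    ≡ fromℕ (t !) * fromℕ (∣ ∁ I ∣ !) * h (map (gapWeight x) (gapFlags C)) ∣ ∁ I ∣
sum-over-perms x {n} {t} I C ∣I∣≡t = begin
  sumℚ (map (λ π → x ^ℚ sizeJC I C π) (perms n))
    ≡⟨ sumℚ-filter (λ w → UniqueDec.unique? _≟_ (toList w)) (λ π → x ^ℚ sizeJC I C π) (words n n) ⟩
  sumℚ (map (λ w → if distinct w then x ^ℚ sizeJC I C w else 0ℚ) (words n n))
    ≡⟨ cong sumℚ (Listₚ.map-cong as-wordWeight (words n n)) ⟩
  weightedSum (λ _ → false) n (gapFlags C)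
    ≡⟨ weightedSum≡h n (λ _ → false) (gapFlags C) t ∣ ∁ I ∣ (trans (count-∈ I) ∣I∣≡t) (count-∉ I)
         (trans (sym (∣p∣+∣∁p∣≡n I)) (cong (ℕ._+ ∣ ∁ I ∣) ∣I∣≡t)) (cong suc (Vecₚ.length-toList C)) ⟩
  fromℕ (t !) * fromℕ (∣ ∁ I ∣ !) * h (map (gapWeight x) (gapFlags C)) ∣ ∁ I ∣ ∎
  where
  open ≡-Reasoning
  open InjectiveWords x I
  as-wordWeight : ∀ w → (if distinct w then x ^ℚ sizeJC I C w else 0ℚ) ≡ wordWeight (λ _ → false) (gapFlags C) w
  as-wordWeight w rewrite avoids-none w | Boolₚ.∧-identityʳ (distinct w) with distinct w in distinct-w
  ... | true  = cong (x ^ℚ_) (sizeJC≡gapCount I C w distinct-w)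
  ... | false = refl

sumℚ-ones : ∀ {A : Set} (xs : List A) → sumℚ (map (λ _ → 1ℚ) xs) ≡ fromℕ (length xs)
sumℚ-ones []       = sym fromℕ-0
sumℚ-ones (x ∷ xs) = trans (cong (λ q → 1ℚ + q) (sumℚ-ones xs)) (sym (fromℕ-suc (length xs)))

length-perms : ∀ {n t} (I : Subset n) (C : Subset t) → ∣ I ∣ ≡ t →
  fromℕ (length (perms n)) ≡ fromℕ (t !) * fromℕ (∣ ∁ I ∣ !) * multichoose (suc t) ∣ ∁ I ∣
length-perms {n} {t} I C ∣I∣≡t = begin
  fromℕ (length (perms n))
    ≡⟨ sym (sumℚ-ones (perms n)) ⟩
  sumℚ (map (λ _ → 1ℚ) (perms n))
    ≡⟨ cong sumℚ (Listₚ.map-cong (λ π → sym (1^ℚ (sizeJC I C π))) (perms n)) ⟩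
  sumℚ (map (λ π → 1ℚ ^ℚ sizeJC I C π) (perms n))
    ≡⟨ sum-over-perms 1ℚ I C ∣I∣≡t ⟩
  F * h (map (gapWeight 1ℚ) (gapFlags C)) ∣ ∁ I ∣
    ≡⟨ cong (λ ws → F * h ws ∣ ∁ I ∣) (gapWeights-1 (gapFlags C)) ⟩
  F * h (replicate (suc (length (toList C))) 1ℚ) ∣ ∁ I ∣
    ≡⟨ cong (λ k → F * multichoose (suc k) ∣ ∁ I ∣) (Vecₚ.length-toList C) ⟩
  F * multichoose (suc t) ∣ ∁ I ∣ ∎
  where
  open ≡-Reasoning
  F = fromℕ (t !) * fromℕ (∣ ∁ I ∣ !)

-- The case L = 0 never occurs, and invℕ 0 = 0 makes it trivial anyway.
expectation-≤ : ∀ {S L F a m y b} → S ≡ F * a → fromℕ L ≡ F * m → 0ℚ ≤ F → 0ℚ ≤ b →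
  a * y ≤ b * m → S * invℕ L * y ≤ b
expectation-≤ {S} {zero} {y = y} _ _ _ 0≤b _ =
  ℚₚ.≤-trans (ℚₚ.≤-reflexive (trans (cong (_* y) (ℚₚ.*-zeroʳ S)) (ℚₚ.*-zeroˡ y))) 0≤b
expectation-≤ {S} {suc k} {F} {a} {m} {y} {b} refl L≡Fm 0≤F _ ay≤bm = begin
  F * a * inv * y          ≡⟨ solve 4 (λ F a i y → F :* a :* i :* y := i :* F :* (a :* y)) refl F a inv y ⟩
  inv * F * (a * y)        ≤⟨ *-monoˡ-≤ (*-nonNeg (invℕ-nonNeg (suc k)) 0≤F) ay≤bm ⟩
  inv * F * (b * m)        ≡⟨ solve 4 (λ i F b m → i :* F :* (b :* m) := b :* (i :* (F :* m))) refl inv F b m ⟩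
  b * (inv * (F * m))      ≡⟨ cong (λ q → b * (inv * q)) (sym L≡Fm) ⟩
  b * (inv * fromℕ (suc k)) ≡⟨ cong (b *_) (invℕ-inverse k) ⟩
  b * 1ℚ                   ≡⟨ ℚₚ.*-identityʳ b ⟩
  b                        ∎
  where
  open ℚₚ.≤-Reasoning
  inv = invℕ (suc k)

lemma2p8 : (n t : ℕ) (I : Subset n) → ∣ I ∣ ≡ t →
           (c : ℕ) (C : Subset t) → ∣ C ∣ ≡ c →
           (x : ℚ) → 0ℚ < x → x < 1ℚ →
           E-perm n (λ π → x ^ℚ sizeJC I C π) * (((+ n / 1) * (1ℚ - x)) ^ℚ c)
             ≤ (+ t / 1) ^ℚ c
lemma2p8 n t I ∣I∣≡t c C refl x 0<x x<1 =
  subst₂ (λ n' t' → E-perm n (λ π → x ^ℚ sizeJC I C π) * ((n' * (1ℚ - x)) ^ℚ c) ≤ t' ^ℚ c)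
    (fromℕ≡/1 n) (fromℕ≡/1 t)
    (expectation-≤ (sum-over-perms x I C ∣I∣≡t) (length-perms I C ∣I∣≡t)
      (*-nonNeg (fromℕ-nonNeg _) (fromℕ-nonNeg _)) (^ℚ-nonNeg c (fromℕ-nonNeg t)) bound)
  where
  open NegativeBinomial x (ℚₚ.<⇒≤ 0<x)
  v = ∣ ∁ I ∣
  d = ∣ ∁ C ∣
  c+d≡t : c ℕ.+ d ≡ t
  c+d≡t = ∣p∣+∣∁p∣≡n C
  t+v≡n : t ℕ.+ v ≡ n
  t+v≡n = trans (cong (ℕ._+ v) (sym ∣I∣≡t)) (∣p∣+∣∁p∣≡n I)
  ws = map (gapWeight x) (gapFlags C)
  sorted : ws ↭ replicate c x ++ replicate (suc d) 1ℚ
  sorted = ↭.trans (↭.prep 1ℚ (gapWeights-↭ x C)) (↭.↭-sym (↭ₚ.shift 1ℚ (replicate c x) (replicate d 1ℚ)))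
  bound : h ws v * (fromℕ n * (1ℚ - x)) ^ℚ c ≤ fromℕ t ^ℚ c * multichoose (suc t) v
  bound = subst₂ (λ n' t' → h ws v * (fromℕ n' * (1ℚ - x)) ^ℚ c ≤ fromℕ t' ^ℚ c * multichoose (suc t') v)
    (trans (cong (ℕ._+ v) c+d≡t) t+v≡n) c+d≡t (h-bound (ℚₚ.<⇒≤ x<1) c d v sorted)
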